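{- Let $G$ be a finite simple graph that is vertex-critical for Property $(\star)$. Then $G$ contains no clique cutset.
   Context: Property $(\star)$ for a graph $G$ means $\chi(G) > \Delta_2(G)+3$, where $\Delta_2(G)$ is the maximum, over distinct vertices $u,v$, of the number of common neighbors of $u$ and $v$. $G$ is vertex-critical for Property $(\star)$ if $G$ satisfies Property $(\star)$ but no proper induced subgraph of $G$ does. A clique cutset of a connected graph $G$ is a clique $K$ such that $G\setminus K$ is disconnected. -}

module Defs where

open import Data.Nat using (ℕ; zero; suc; _+_; _<_; _⊔_)
open import Data.Fin using (Fin)
open import Data.Bool using (Bool; true; false; _∧_; not)
open import Data.List using (List; map; foldr; concatMap; filter; length)
open import Data.List using (allFin)
open import Data.Product using (Σ; _×_; _,_; ∃)
open import Relation.Binary.PropositionalEquality using (_≡_; _≢_)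
open import Relation.Nullary using (¬_)

record Graph : Set where
  field
    n     : ℕ
    adj   : Fin n → Fin n → Bool
    sym   : ∀ u v → adj u v ≡ adj v u
    irrefl : ∀ v → adj v v ≡ false
open Graph public

-- Vertex subsets (used to describe induced subgraphs G[S]).
VSet : Graph → Set
VSet G = Fin (n G) → Bool

full : (G : Graph) → VSet G
full G _ = true

countB : {A : Set} → (A → Bool) → List A → ℕ
countB p = foldr (λ a k → bump (p a) k) 0
  where
  bump : Bool → ℕ → ℕ
  bump true  k = suc k
  bump false k = k

commonNbrs : (G : Graph) → VSet G → Fin (n G) → Fin (n G) → ℕ
commonNbrs G S u v = countB (λ w → S w ∧ adj G u w ∧ adj G v w) (allFin (n G))

-- Δ₂(G[S]) : maximum over distinct u, v ∈ S of the number of common neighbours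
-- (maximum over the empty set taken to be 0)
Δ₂ : (G : Graph) → VSet G → ℕ
Δ₂ G S = foldr _⊔_ 0
  (concatMap (λ u → map (λ v → pairVal u v) (allFin (n G))) (allFin (n G)))
  where
  open import Data.Fin using (_≟_)
  open import Relation.Nullary using (yes; no)
  pairVal : Fin (n G) → Fin (n G) → ℕ
  pairVal u v with u ≟ v
  ... | yes _ = 0
  ... | no _  = if S u ∧ S v then commonNbrs G S u v else 0
    where open import Data.Bool using (if_then_else_)

Colourable : (G : Graph) → VSet G → ℕ → Set
Colourable G S k = Σ (Fin (n G) → Fin k) λ c →
  ∀ u v → S u ≡ true → S v ≡ true → adj G u v ≡ true → c u ≢ c v

IsChromaticNumber : (G : Graph) → VSet G → ℕ → Set
IsChromaticNumber G S k = Colourable G S k × (∀ j → j < k → ¬ Colourable G S j)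

Star : (G : Graph) → VSet G → Set
Star G S = Σ ℕ λ k → IsChromaticNumber G S k × (Δ₂ G S + 3 < k)

VertexCritical : Graph → Set
VertexCritical G = Star G (full G) ×
  (∀ (S : VSet G) → (∃ λ v → S v ≡ false) → ¬ Star G S)

data Walk (G : Graph) (T : VSet G) : Fin (n G) → Fin (n G) → Set where
  here : ∀ {u} → T u ≡ true → Walk G T u u
  step : ∀ {u w v} → T u ≡ true → adj G u w ≡ true → Walk G T w v → Walk G T u v

minus : (G : Graph) → VSet G → VSet G
minus G K v = not (K v)

Disconnected : (G : Graph) → VSet G → Set
Disconnected G T = Σ (Fin (n G)) λ u → Σ (Fin (n G)) λ v →
  T u ≡ true × T v ≡ true × ¬ Walk G T u v

IsClique : (G : Graph) → VSet G → Set
IsClique G K = ∀ u v → K u ≡ true → K v ≡ true → u ≢ v → adj G u v ≡ true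

IsCliqueCutset : (G : Graph) → VSet G → Set
IsCliqueCutset G K = IsClique G K × Disconnected G (minus G K)

{-# OPTIONS --safe #-}

-- Write χ(G) = k + 1. A proper induced subgraph H of G satisfies Δ₂(H) ≤ Δ₂(G), so it would
-- have (⋆) if χ(H) were k + 1; hence χ(H) ≤ k. Suppose a clique K separates u from v, and let
-- R be the set of vertices reachable from u in G − K. Then G[K ∪ R] and G − R are proper
-- induced subgraphs, hence k-colourable. Both colourings are injective on the clique K, so
-- permuting the colours of the second makes them agree on K; as every edge leaving R ends in
-- K, they glue to a k-colouring of G, which is impossible.
-- Since the goal is ⊥, the argument runs in the double-negation monad, which supplies the
-- classical steps: χ(H) ≤ k, and deciding reachability.
module Submission where

open import Defs hiding (sym)
open import Relation.Nullary using (¬_)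

open import Data.Bool using (Bool; true; false; _∧_; _∨_; not; if_then_else_)
open import Data.Bool.Properties using (∨-zeroʳ; ∨-identityʳ; not-injective)
open import Data.Fin using (Fin; zero; suc; inject≤)
open import Data.Fin.Properties using (_≟_; inject≤-injective; ∀-cons)
import Data.Fin.Permutation.Components as Components
open import Data.List using (List; []; _∷_; foldr; map; concatMap; allFin)
open import Data.List.Membership.Propositional using (_∈_)
open import Data.List.Membership.Propositional.Properties using (∈-allFin)
open import Data.List.Relation.Unary.Any using (here; there)
import Data.List.Relation.Binary.Pointwise as Pointwise
open Pointwise using (Pointwise)
open import Data.Nat using (ℕ; zero; suc; _+_; _≤_; _<_; _⊔_; z≤n; s≤s)
open import Data.Nat.Properties
  using (⊔-mono-≤; m≤n⇒m≤1+n; +-monoˡ-≤; ≤-<-trans; n<1+n; module ≤-Reasoning)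
open import Data.Product using (Σ; _×_; _,_; ∃)
open import Data.Sum using (_⊎_; inj₁; inj₂)
open import Effect.Monad using (RawMonad)
open import Function using (id; _∘_)
open import Function.Definitions using (Injective)
open import Level using (0ℓ)
open import Relation.Binary.Definitions using (DecidableEquality)
open import Relation.Binary.PropositionalEquality using (_≡_; _≢_; refl; sym; trans; cong; module ≡-Reasoning)
open import Relation.Nullary using (Dec; yes; no; does)
open import Relation.Nullary.Decidable using (¬¬-excluded-middle; dec-true; dec-false)
open import Relation.Nullary.Negation using (DoubleNegation; ¬¬-Monad; contradiction)

open RawMonad (¬¬-Monad {0ℓ}) using (_>>=_; pure)

_⊆_ : ∀ {m} → (Fin m → Bool) → (Fin m → Bool) → Set
S ⊆ T = ∀ x → S x ≡ true → T x ≡ true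

_∪_ : ∀ {m} → (Fin m → Bool) → (Fin m → Bool) → Fin m → Bool
(S ∪ T) x = S x ∨ T x

∪-introˡ : ∀ {m} {S T : Fin m → Bool} → S ⊆ (S ∪ T)
∪-introˡ x Sx rewrite Sx = refl

∪-introʳ : ∀ {m} {S T : Fin m → Bool} → T ⊆ (S ∪ T)
∪-introʳ {S = S} x Tx rewrite Tx = ∨-zeroʳ (S x)

∪-false : ∀ {m} {S T : Fin m → Bool} x → S x ≡ false → T x ≡ false → (S ∪ T) x ≡ false
∪-false x Sx Tx rewrite Sx | Tx = refl

true-or-false : ∀ b → b ≡ true ⊎ b ≡ false
true-or-false true  = inj₁ refl
true-or-false false = inj₂ refl

∨-false-elim : ∀ {a} → a ∨ false ≡ true → a ≡ true
∨-false-elim {a} = trans (sym (∨-identityʳ a))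

countB-mono : ∀ {A : Set} {p q : A → Bool} → (∀ a → p a ≡ true → q a ≡ true) →
              ∀ xs → countB p xs ≤ countB q xs
countB-mono p⇒q [] = z≤n
countB-mono {p = p} {q} p⇒q (a ∷ xs) with p a in pa | q a in qa
... | true  | true  = s≤s (countB-mono p⇒q xs)
... | true  | false = contradiction (trans (sym (p⇒q a pa)) qa) λ ()
... | false | true  = m≤n⇒m≤1+n (countB-mono p⇒q xs)
... | false | false = countB-mono p⇒q xs

∧-monoˡ-true : ∀ {a b} c → (a ≡ true → b ≡ true) → a ∧ c ≡ true → b ∧ c ≡ true
∧-monoˡ-true {true} c a⇒b ac rewrite a⇒b refl = ac

commonNbrs-mono : ∀ (G : Graph) {S T : VSet G} → S ⊆ T →
                  ∀ u v → commonNbrs G S u v ≤ commonNbrs G T u v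
commonNbrs-mono G S⊆T u v =
  countB-mono (λ w → ∧-monoˡ-true (adj G u w ∧ adj G v w) (S⊆T w)) (allFin (n G))

maxOverPairs : ∀ {m} → (Fin m → Fin m → ℕ) → ℕ
maxOverPairs {m} f = foldr _⊔_ 0 (concatMap (λ u → map (f u) (allFin m)) (allFin m))

foldr-⊔-mono : ∀ {xs ys : List ℕ} → Pointwise _≤_ xs ys → foldr _⊔_ 0 xs ≤ foldr _⊔_ 0 ys
foldr-⊔-mono = Pointwise.foldr⁺ ⊔-mono-≤ z≤n

maxOverPairs-mono : ∀ {m} {f g : Fin m → Fin m → ℕ} → (∀ u v → f u v ≤ g u v) →
                    maxOverPairs f ≤ maxOverPairs g
maxOverPairs-mono {m} {f} {g} f≤g =
  foldr-⊔-mono (Pointwise.concat⁺ (mapPointwise (λ u → mapPointwise (f≤g u))))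
  where
  mapPointwise : ∀ {A : Set} {R : A → A → Set} {h k : Fin m → A} → (∀ v → R (h v) (k v)) →
                 Pointwise R (map h (allFin m)) (map k (allFin m))
  mapPointwise R[h,k] = Pointwise.map⁺ _ _ (Pointwise.refl λ {v} → R[h,k] v)

-- Δ₂ evaluates each pair through a helper local to its definition, which cannot be
-- referred to; abstracting the goal over _≟_ makes unification name it.
mutual
  pairValue : (G : Graph) → VSet G → DecidableEquality (Fin (n G)) → Fin (n G) → Fin (n G) → ℕ
  pairValue = _

  Δ₂-unfold : ∀ G S → Δ₂ G S ≡ maxOverPairs (pairValue G S _≟_)
  Δ₂-unfold G S with _≟_ {n G}
  ... | _ = refl

pairValue-mono : ∀ (G : Graph) {S T : VSet G} → S ⊆ T →
                 ∀ u v → pairValue G S _≟_ u v ≤ pairValue G T _≟_ u v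
pairValue-mono G {S} {T} S⊆T u v with u ≟ v
... | yes _ = z≤n
... | no _ with S u in Su | S v in Sv
...   | false | _     = z≤n
...   | true  | false = z≤n
...   | true  | true  rewrite S⊆T u Su | S⊆T v Sv = commonNbrs-mono G S⊆T u v

Δ₂-mono : ∀ (G : Graph) {S T : VSet G} → S ⊆ T → Δ₂ G S ≤ Δ₂ G T
Δ₂-mono G {S} {T} S⊆T = begin
  Δ₂ G S                              ≡⟨ Δ₂-unfold G S ⟩
  maxOverPairs (pairValue G S _≟_)    ≤⟨ maxOverPairs-mono (pairValue-mono G S⊆T) ⟩
  maxOverPairs (pairValue G T _≟_)    ≡⟨ sym (Δ₂-unfold G T) ⟩
  Δ₂ G T                              ∎
  where open ≤-Reasoning

InjectiveOn : ∀ {A B : Set} → (A → Bool) → (A → B) → Set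
InjectiveOn P f = ∀ {x y} → P x ≡ true → P y ≡ true → f x ≡ f y → x ≡ y

IsProperColouring : (G : Graph) → VSet G → ∀ {k} → (Fin (n G) → Fin k) → Set
IsProperColouring G S c = ∀ u v → S u ≡ true → S v ≡ true → adj G u v ≡ true → c u ≢ c v

module _ (G : Graph) where

  colourable-⊆ : ∀ {S T k} → S ⊆ T → Colourable G T k → Colourable G S k
  colourable-⊆ S⊆T (c , proper) =
    c , λ u v Su Sv uv → proper u v (S⊆T u Su) (S⊆T v Sv) uv

  colourable-≤ : ∀ {S j k} → j ≤ k → Colourable G S j → Colourable G S k
  colourable-≤ j≤k (c , proper) =
    (λ x → inject≤ (c x) j≤k) , λ u v Su Sv uv → proper u v Su Sv uv ∘ inject≤-injective j≤k j≤k _ _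

  properColouring-∘ : ∀ {S k} {c : Fin (n G) → Fin k} {σ : Fin k → Fin k} →
                      Injective _≡_ _≡_ σ → IsProperColouring G S c → IsProperColouring G S (σ ∘ c)
  properColouring-∘ σ-inj proper u v Su Sv uv = proper u v Su Sv uv ∘ σ-inj

  properColouring-cong : ∀ {S k} {c c′ : Fin (n G) → Fin k} → (∀ x → S x ≡ true → c x ≡ c′ x) →
                         IsProperColouring G S c′ → IsProperColouring G S c
  properColouring-cong c≗c′ proper u v Su Sv uv cu≡cv =
    proper u v Su Sv uv (trans (sym (c≗c′ u Su)) (trans cu≡cv (c≗c′ v Sv)))

  properColouring-injectiveOn-clique : ∀ {K S k} {c : Fin (n G) → Fin k} → IsClique G K → K ⊆ S →
                                       IsProperColouring G S c → InjectiveOn K c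
  properColouring-injectiveOn-clique {K} clique K⊆S proper {x} {y} Kx Ky cx≡cy with x ≟ y
  ... | yes x≡y = x≡y
  ... | no x≢y = contradiction cx≡cy (proper x y (K⊆S x Kx) (K⊆S y Ky) (clique x y Kx Ky x≢y))

transpose-matchˡ : ∀ {k} (i j : Fin k) → Components.transpose i j i ≡ j
transpose-matchˡ i j rewrite dec-true (i ≟ i) refl = refl

transpose-fix : ∀ {k} {i j l : Fin k} → l ≢ i → l ≢ j → Components.transpose i j l ≡ l
transpose-fix {i = i} {j} {l} l≢i l≢j rewrite dec-false (l ≟ i) l≢i | dec-false (l ≟ j) l≢j = refl

transpose-injective : ∀ {k} (i j : Fin k) → Injective _≡_ _≡_ (Components.transpose i j)
transpose-injective i j {x} {y} τx≡τy = begin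
  x                                                            ≡⟨ sym (Components.transpose-inverse j i) ⟩
  Components.transpose j i (Components.transpose i j x)        ≡⟨ cong (Components.transpose j i) τx≡τy ⟩
  Components.transpose j i (Components.transpose i j y)        ≡⟨ Components.transpose-inverse j i ⟩
  y                                                            ∎
  where open ≡-Reasoning

module _ {A : Set} {k : ℕ} (P : A → Bool) {c₁ c₂ : A → Fin k}
         (c₁-inj : InjectiveOn P c₁) (c₂-inj : InjectiveOn P c₂) where

  -- Each step composes with the transposition moving the current colour of y to c₁ y;
  -- injectivity of c₁ and c₂ on P makes it fix the colours already matched.
  recolouring : (xs : List A) → Σ (Fin k → Fin k) λ σ →
                Injective _≡_ _≡_ σ × (∀ {x} → x ∈ xs → P x ≡ true → σ (c₂ x) ≡ c₁ x)
  recolouring [] = id , id , λ ()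
  recolouring (y ∷ xs) with recolouring xs | P y in Py
  ... | σ , σ-inj , matched | false = σ , σ-inj , matched′
    where
    matched′ : ∀ {x} → x ∈ y ∷ xs → P x ≡ true → σ (c₂ x) ≡ c₁ x
    matched′ (here refl) Px = contradiction (trans (sym Px) Py) λ ()
    matched′ (there x∈xs) Px = matched x∈xs Px
  ... | σ , σ-inj , matched | true = τ ∘ σ , σ-inj ∘ transpose-injective _ _ , matched′
    where
    τ : Fin k → Fin k
    τ = Components.transpose (σ (c₂ y)) (c₁ y)
    matched′ : ∀ {x} → x ∈ y ∷ xs → P x ≡ true → τ (σ (c₂ x)) ≡ c₁ x
    matched′ (here refl) _ = transpose-matchˡ (σ (c₂ y)) (c₁ y)
    matched′ {x} (there x∈xs) Px with c₁ x ≟ c₁ y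
    ... | yes c₁x≡c₁y with refl ← c₁-inj Px Py c₁x≡c₁y = transpose-matchˡ (σ (c₂ y)) (c₁ y)
    ... | no c₁x≢c₁y = trans (cong τ (matched x∈xs Px)) (transpose-fix c₁x≢σc₂y c₁x≢c₁y)
      where
      c₁x≢σc₂y : c₁ x ≢ σ (c₂ y)
      c₁x≢σc₂y e = c₁x≢c₁y (cong c₁ (c₂-inj Px Py (σ-inj (trans (matched x∈xs Px) e))))

¬¬-pull-Fin : ∀ {m} {P : Fin m → Set} → (∀ i → DoubleNegation (P i)) → DoubleNegation (∀ i → P i)
¬¬-pull-Fin {zero}  _   = pure λ ()
¬¬-pull-Fin {suc m} ¬¬P = do
  P₀ ← ¬¬P zero
  Pₛ ← ¬¬-pull-Fin (¬¬P ∘ suc)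
  pure (∀-cons P₀ Pₛ)

¬star⇒colourable : ∀ {G S k} → Colourable G S (suc k) → Δ₂ G S + 3 < suc k → ¬ Star G S →
                   DoubleNegation (Colourable G S k)
¬star⇒colourable {G} {S} {k} colourable Δ₂<k+1 ¬star ¬colourable =
  ¬star (suc k , (colourable , minimal) , Δ₂<k+1)
  where
  minimal : ∀ j → j < suc k → ¬ Colourable G S j
  minimal j (s≤s j≤k) = ¬colourable ∘ colourable-≤ G j≤k

walk-snoc : ∀ {G T x y z} → Walk G T x y → adj G y z ≡ true → T z ≡ true → Walk G T x z
walk-snoc (here Tx)       yz Tz = step Tx yz (here Tz)
walk-snoc (step Tx xw wy) yz Tz = step Tx xw (walk-snoc wy yz Tz)

module Reachable (G : Graph) (T : VSet G) (u : Fin (n G))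
                 (reach? : ∀ x → Dec (Walk G T u x)) where

  R : VSet G
  R x = does (reach? x)

  R-source : T u ≡ true → R u ≡ true
  R-source Tu with reach? u
  ... | yes _ = refl
  ... | no ¬walk = contradiction (here Tu) ¬walk

  R-unreachable : ∀ {v} → ¬ Walk G T u v → R v ≡ false
  R-unreachable {v} ¬walk with reach? v
  ... | yes walk = contradiction walk ¬walk
  ... | no _ = refl

  R-boundary : ∀ x y → R x ≡ true → R y ≡ false → adj G x y ≡ true → T y ≡ false
  R-boundary x y Rx Ry xy with reach? x | reach? y | T y in Ty
  ... | yes walk | no ¬walk | true = contradiction (walk-snoc walk xy Ty) ¬walk
  ... | yes _    | no _     | false = refl

module Gluing (G : Graph) (K R : VSet G)
              (R-boundary : ∀ x y → R x ≡ true → R y ≡ false → adj G x y ≡ true → K y ≡ true)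
              {k : ℕ} (c₁ c₂ : Fin (n G) → Fin k)
              (c₁≗c₂-on-K : ∀ x → K x ≡ true → c₁ x ≡ c₂ x) where

  inside outside : VSet G
  inside  = K ∪ R
  outside = K ∪ minus G R

  K⊆inside : K ⊆ inside
  K⊆inside = ∪-introˡ {S = K} {T = R}

  R⊆inside : R ⊆ inside
  R⊆inside = ∪-introʳ {S = K} {T = R}

  R̅⊆outside : minus G R ⊆ outside
  R̅⊆outside = ∪-introʳ {S = K} {T = minus G R}

  glued : Fin (n G) → Fin k
  glued x = if R x then c₁ x else c₂ x

  glued-inside : ∀ x → inside x ≡ true → glued x ≡ c₁ x
  glued-inside x x∈ with R x
  ... | true  = refl
  ... | false = sym (c₁≗c₂-on-K x (∨-false-elim x∈))

  glued-outside : ∀ x → outside x ≡ true → glued x ≡ c₂ x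
  glued-outside x x∈ with R x
  ... | true  = c₁≗c₂-on-K x (∨-false-elim x∈)
  ... | false = refl

  edge-side : ∀ x y → adj G x y ≡ true →
              (inside x ≡ true × inside y ≡ true) ⊎ (outside x ≡ true × outside y ≡ true)
  edge-side x y xy with true-or-false (R x) | true-or-false (R y)
  ... | inj₁ Rx | inj₁ Ry = inj₁ (R⊆inside x Rx , R⊆inside y Ry)
  ... | inj₁ Rx | inj₂ Ry = inj₁ (R⊆inside x Rx , K⊆inside y (R-boundary x y Rx Ry xy))
  ... | inj₂ Rx | inj₁ Ry =
    inj₁ (K⊆inside x (R-boundary y x Ry Rx (trans (Graph.sym G y x) xy)) , R⊆inside y Ry)
  ... | inj₂ Rx | inj₂ Ry = inj₂ (R̅⊆outside x (cong not Rx) , R̅⊆outside y (cong not Ry))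

  glued-proper : IsProperColouring G inside c₁ → IsProperColouring G outside c₂ →
                 IsProperColouring G (full G) glued
  glued-proper proper₁ proper₂ x y _ _ xy with edge-side x y xy
  ... | inj₁ (x∈ , y∈) = properColouring-cong G glued-inside proper₁ x y x∈ y∈ xy
  ... | inj₂ (x∈ , y∈) = properColouring-cong G glued-outside proper₂ x y x∈ y∈ xy

module _ (G : Graph) {k : ℕ}
         (properSubgraph-colourable :
            ∀ S → (∃ λ v → S v ≡ false) → DoubleNegation (Colourable G S k)) where

  cliqueSeparator-colourable :
    ∀ {K R} → IsClique G K →
    (∀ x y → R x ≡ true → R y ≡ false → adj G x y ≡ true → K y ≡ true) →
    (∃ λ v → (K ∪ R) v ≡ false) → (∃ λ u → (K ∪ minus G R) u ≡ false) →
    DoubleNegation (Colourable G (full G) k)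
  cliqueSeparator-colourable {K} {R} clique R-boundary missing₁ missing₂ = do
    (c₁ , proper₁) ← properSubgraph-colourable (K ∪ R) missing₁
    (c₂ , proper₂) ← properSubgraph-colourable (K ∪ minus G R) missing₂
    let σ , σ-inj , matched = recolouring K (injectiveOn-K proper₁) (injectiveOn-K proper₂) (allFin (n G))
        open Gluing G K R R-boundary c₁ (σ ∘ c₂) (λ x Kx → sym (matched (∈-allFin x) Kx))
    pure (glued , glued-proper proper₁ (properColouring-∘ G σ-inj proper₂))
    where
    injectiveOn-K : ∀ {T} {c : Fin (n G) → Fin k} → IsProperColouring G (K ∪ T) c → InjectiveOn K c
    injectiveOn-K {T} = properColouring-injectiveOn-clique G clique (∪-introˡ {S = K} {T = T})

  cliqueCutset-colourable : ∀ {K} → IsCliqueCutset G K → DoubleNegation (Colourable G (full G) k)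
  cliqueCutset-colourable {K} (clique , u , v , u∉K , v∉K , ¬walk) = do
    reach? ← ¬¬-pull-Fin (λ _ → ¬¬-excluded-middle)
    let open Reachable G (minus G K) u reach?
    cliqueSeparator-colourable clique
      (λ x y Rx Ry xy → not-injective (R-boundary x y Rx Ry xy))
      (v , ∪-false {S = K} {T = R} v (not-injective v∉K) (R-unreachable ¬walk))
      (u , ∪-false {S = K} {T = minus G R} u (not-injective u∉K) (cong not (R-source u∉K)))

lemma3p1 : (G : Graph) → VertexCritical G → (K : VSet G) → ¬ IsCliqueCutset G K
lemma3p1 G ((zero , _ , ()) , _) K
lemma3p1 G ((suc k , (colourable , minimal) , Δ₂<χ) , critical) K cutset =
  cliqueCutset-colourable G properSubgraph-colourable cutset (minimal k (n<1+n k))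
  where
  properSubgraph-colourable : ∀ S → (∃ λ v → S v ≡ false) → DoubleNegation (Colourable G S k)
  properSubgraph-colourable S missing =
    ¬star⇒colourable (colourable-⊆ G (λ _ _ → refl) colourable)
                     (≤-<-trans (+-monoˡ-≤ 3 (Δ₂-mono G (λ _ _ → refl))) Δ₂<χ)
                     (critical S missing)
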